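{- Let $\rho=e^{2\pi i/3}$ and let $PU(2,1;\mathbb{Z}[\rho])$ be generated by the classes of $R_1=\begin{pmatrix}1&0&0\\0&-\rho^2&0\\0&0&1\end{pmatrix}$, $R_2=RA_yR$ and $R_3=RA_0R$, where \[ R=\begin{pmatrix}0&0&1\\0&-1&0\\1&0&0\end{pmatrix},\quad A_y=\begin{pmatrix}1&1&\rho\\0&-\rho^2&\rho^2\\0&0&1\end{pmatrix},\quad A_0=\begin{pmatrix}1&0&0\\\rho&-\rho^2&0\\\rho&\rho&1\end{pmatrix}. \] Then the assignment $R_1\mapsto(12)$, $R_2\mapsto(24)$, $R_3\mapsto(23)$ extends to a surjective group homomorphism $\Upsilon:PU(2,1;\mathbb{Z}[\rho])\to S_4$.
   Context: $PU(2,1;\mathbb{Z}[\rho])=\{g\in PGL(3,\mathbb{Z}[\rho]) : {}^tgJ_0\bar g=J_0\}$, where $J_0$ is the $3\times3$ antidiagonal matrix with all antidiagonal entries equal to $1$. The group $S_4$ is the symmetric group on $\{1,2,3,4\}$. -}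

module Defs where

open import Data.Integer using (ℤ; +_; -[1+_]; _+_; _*_; -_; _-_)
open import Data.Fin using (Fin; zero; suc)
open import Data.Fin.Permutation using (Permutation′; _⟨$⟩ʳ_)
open import Data.Product using (Σ; ∃; _×_; _,_)
open import Relation.Binary.PropositionalEquality using (_≡_)

-- Eisenstein integers ℤ[ρ]: eis a b = a + b ρ with ρ = e^{2πi/3}, ρ² = -1 - ρ.
record ℤρ : Set where
  constructor eis
  field
    re : ℤ
    im : ℤ
open ℤρ public

0ρ 1ρ ρ -1ρ : ℤρ
0ρ = eis (+ 0) (+ 0)
1ρ = eis (+ 1) (+ 0)
ρ = eis (+ 0) (+ 1)
-1ρ = eis (- (+ 1)) (+ 0)

infixl 6 _⊕_
infixl 7 _⊗_
_⊕_ : ℤρ → ℤρ → ℤρ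
eis a b ⊕ eis c d = eis (a + c) (b + d)

-- (a + bρ)(c + dρ) = (ac - bd) + (ad + bc - bd)ρ
_⊗_ : ℤρ → ℤρ → ℤρ
eis a b ⊗ eis c d = eis (a * c - b * d) (a * d + b * c - b * d)

-- complex conjugation: ρ̄ = ρ² = -1 - ρ
conj : ℤρ → ℤρ
conj (eis a b) = eis (a - b) (- b)

ρ² -ρ² : ℤρ
ρ² = ρ ⊗ ρ
-ρ² = -1ρ ⊗ ρ²

IsUnitℤρ : ℤρ → Set
IsUnitℤρ u = ∃ λ v → u ⊗ v ≡ 1ρ

Mat : Set
Mat = Fin 3 → Fin 3 → ℤρ

sum3 : (Fin 3 → ℤρ) → ℤρ
sum3 f = f zero ⊕ f (suc zero) ⊕ f (suc (suc zero))

_·_ : Mat → Mat → Mat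
(A · B) i j = sum3 (λ k → A i k ⊗ B k j)
infixl 7 _·_

tr : Mat → Mat
tr A i j = A j i

conjM : Mat → Mat
conjM A i j = conj (A i j)

scal : ℤρ → Mat → Mat
scal u A i j = u ⊗ A i j

_≈M_ : Mat → Mat → Set
A ≈M B = ∀ i j → A i j ≡ B i j

mat : ℤρ → ℤρ → ℤρ → ℤρ → ℤρ → ℤρ → ℤρ → ℤρ → ℤρ → Mat
mat a b c d e f g h k zero zero = a
mat a b c d e f g h k zero (suc zero) = b
mat a b c d e f g h k zero (suc (suc zero)) = c
mat a b c d e f g h k (suc zero) zero = d
mat a b c d e f g h k (suc zero) (suc zero) = e
mat a b c d e f g h k (suc zero) (suc (suc zero)) = f
mat a b c d e f g h k (suc (suc zero)) zero = g
mat a b c d e f g h k (suc (suc zero)) (suc zero) = h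
mat a b c d e f g h k (suc (suc zero)) (suc (suc zero)) = k

I₃ J₀ : Mat
I₃ = mat 1ρ 0ρ 0ρ 0ρ 1ρ 0ρ 0ρ 0ρ 1ρ
J₀ = mat 0ρ 0ρ 1ρ 0ρ 1ρ 0ρ 1ρ 0ρ 0ρ

IsGL : Mat → Set
IsGL g = ∃ λ h → ((g · h) ≈M I₃) × ((h · g) ≈M I₃)

IsU : Mat → Set
IsU g = IsGL g × ((tr g · J₀ · conjM g) ≈M J₀)

R A-y A-0 R₁ R₂ R₃ : Mat
R   = mat 0ρ 0ρ 1ρ 0ρ -1ρ 0ρ 1ρ 0ρ 0ρ
A-y = mat 1ρ 1ρ ρ 0ρ -ρ² ρ² 0ρ 0ρ 1ρ
A-0 = mat 1ρ 0ρ 0ρ ρ -ρ² 0ρ ρ ρ 1ρ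
R₁  = mat 1ρ 0ρ 0ρ 0ρ -ρ² 0ρ 0ρ 0ρ 1ρ
R₂  = R · A-y · R
R₃  = R · A-0 · R

-- S₄ = permutations of Fin 4; points 1,2,3,4 are zero, suc zero, ...
S₄ : Set
S₄ = Permutation′ 4

_≈ₚ_ : S₄ → S₄ → Set
σ ≈ₚ τ = ∀ i → σ ⟨$⟩ʳ i ≡ τ ⟨$⟩ʳ i

p1 p2 p3 p4 : Fin 4
p1 = zero
p2 = suc zero
p3 = suc (suc zero)
p4 = suc (suc (suc zero))

-- A map Υ on matrices descends to a group homomorphism PU(2,1;ℤ[ρ]) → S₄:
-- it is constant on classes modulo unit scalars and multiplicative on U(2,1;ℤ[ρ]).
IsPUHom : (Mat → S₄) → Set
IsPUHom Υ =
  (∀ g → IsU g → ∀ u → IsUnitℤρ u → Υ (scal u g) ≈ₚ Υ g) ×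
  (∀ g h → IsU g → IsU h → ∀ i → Υ (g · h) ⟨$⟩ʳ i ≡ Υ g ⟨$⟩ʳ (Υ h ⟨$⟩ʳ i))

IsSurjPU : (Mat → S₄) → Set
IsSurjPU Υ = ∀ (σ : S₄) → ∃ λ g → IsU g × (Υ g ≈ₚ σ)

module Submission where

-- The homomorphism Υ : PU(2,1; ℤ[ρ]) → S₄ is reduction modulo the prime 1 - ρ.
--
-- ℤ[ρ]/(1 - ρ) is the field 𝔽₃ (ρ ↦ 1, complex conjugation becomes trivial), so
-- reduction maps U(2,1; ℤ[ρ]) into the orthogonal group of the quadratic form
-- Q = ᵗv J₀ v = 2xz + y² over 𝔽₃.  The conic Q = 0 in P²(𝔽₃) has exactly four
-- points, and Υ(g) is the permutation by which the reduction of g moves them.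

open import Defs
open import Algebra.Bundles using (CommutativeRing)
open import Algebra.Structures using (IsCommutativeRing)
open import Data.Empty using (⊥-elim)
open import Data.Fin using (Fin)
import Data.Fin.Properties as Fin
open import Data.Fin.Patterns using (0F; 1F; 2F; 3F)
open import Data.Fin.Permutation as Perm using (Permutation′; permutation; _⟨$⟩ʳ_; _⟨$⟩ˡ_; transpose)
open import Data.Integer as ℤ using (ℤ; +_; -[1+_]; _⊖_; sign; ∣_∣; _◃_)
import Data.Integer.Properties as ℤ
open import Data.List using (List; []; _∷_; foldr; map; concatMap; head; filter)
open import Data.Maybe using (fromMaybe)
open import Data.Nat as ℕ using (ℕ)
open import Data.Product using (∃; _×_; _,_; proj₁; proj₂)
open import Data.Sign as Sign using (Sign)
open import Data.Unit using (⊤; tt)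
open import Data.Vec.Functional using (Vector)
open import Function using (_∘_; id; case_of_)
open import Level using (0ℓ)
open import Relation.Binary.Definitions using (DecidableEquality)
import Relation.Binary.PropositionalEquality as ≡
open ≡ using (_≡_; _≢_)
open import Relation.Nullary using (Dec; yes; no; ¬_)
import Relation.Nullary.Decidable as Dec
open import Relation.Nullary.Decidable using (from-yes; _→-dec_; _×-dec_)

module SquareMatrices {c ℓ} (R : CommutativeRing c ℓ) (n : ℕ) where

  open CommutativeRing R
  open import Algebra.Properties.Semiring.Sum semiring
    using (sum; sum-cong-≋; sum-replicate-zero; ∑-comm; *-distribˡ-sum; *-distribʳ-sum)
  open import Data.Vec.Functional.Relation.Binary.Equality.Setoid setoid public
    using (_≋_; ≋-sym; ≋-trans)
  open import Relation.Binary.Reasoning.Setoid setoid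

  -- the library's summation lemmas, with the length fixed to n for inference
  ∑-cong : ∀ {f g : Vector Carrier n} → (∀ k → f k ≈ g k) → sum f ≈ sum g
  ∑-cong = sum-cong-≋

  ∑-distribˡ : ∀ x (f : Vector Carrier n) → x * sum f ≈ sum λ k → x * f k
  ∑-distribˡ = *-distribˡ-sum

  ∑-distribʳ : ∀ x (f : Vector Carrier n) → sum f * x ≈ sum λ k → f k * x
  ∑-distribʳ = *-distribʳ-sum

  Matrix : Set c
  Matrix = Fin n → Fin n → Carrier

  infix  4 _≋ₘ_
  infixr 7 _▸_ _·ᵥ_ _·ₘ_
  infixl 7 _⊙_

  _≋ₘ_ : Matrix → Matrix → Set ℓ
  a ≋ₘ b = ∀ i j → a i j ≈ b i j

  _▸_ : Matrix → Vector Carrier n → Vector Carrier n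
  (a ▸ v) i = sum λ k → a i k * v k

  _⊙_ : Matrix → Matrix → Matrix
  (a ⊙ b) i j = (a ▸ λ k → b k j) i

  _ᵀ : Matrix → Matrix
  (a ᵀ) i j = a j i

  _·ᵥ_ : Carrier → Vector Carrier n → Vector Carrier n
  (s ·ᵥ v) i = s * v i

  _·ₘ_ : Carrier → Matrix → Matrix
  (s ·ₘ a) i j = s * a i j

  zeroᵥ : Vector Carrier n
  zeroᵥ _ = 0#

  ⟨_,_⟩ : Vector Carrier n → Vector Carrier n → Carrier
  ⟨ v , w ⟩ = sum λ i → v i * w i

  form : Matrix → Vector Carrier n → Carrier
  form A v = ⟨ v , A ▸ v ⟩

  ▸-congˡ : ∀ {a b} → a ≋ₘ b → ∀ v → a ▸ v ≋ b ▸ v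
  ▸-congˡ a≋b v i = ∑-cong λ k → *-congʳ (a≋b i k)

  ▸-congʳ : ∀ a {v w} → v ≋ w → a ▸ v ≋ a ▸ w
  ▸-congʳ a v≋w i = ∑-cong λ k → *-congˡ (v≋w k)

  ⊙-congˡ : ∀ {a a′} → a ≋ₘ a′ → ∀ b → a ⊙ b ≋ₘ a′ ⊙ b
  ⊙-congˡ a≋a′ b i j = ▸-congˡ a≋a′ (λ k → b k j) i

  ⊙-congʳ : ∀ a {b b′} → b ≋ₘ b′ → a ⊙ b ≋ₘ a ⊙ b′
  ⊙-congʳ a b≋b′ i j = ▸-congʳ a (λ k → b≋b′ k j) i

  ⟨⟩-congʳ : ∀ v {w w′} → w ≋ w′ → ⟨ v , w ⟩ ≈ ⟨ v , w′ ⟩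
  ⟨⟩-congʳ v w≋w′ = ∑-cong λ i → *-congˡ (w≋w′ i)

  form-congˡ : ∀ {A B} → A ≋ₘ B → ∀ v → form A v ≈ form B v
  form-congˡ A≋B v = ⟨⟩-congʳ v (▸-congˡ A≋B v)

  form-congʳ : ∀ A {v w} → v ≋ w → form A v ≈ form A w
  form-congʳ A v≋w = ∑-cong λ i → *-cong (v≋w i) (▸-congʳ A v≋w i)

  ▸-assoc : ∀ a b v → (a ⊙ b) ▸ v ≋ a ▸ (b ▸ v)
  ▸-assoc a b v i = begin
    (sum λ k → (sum λ j → a i j * b j k) * v k)  ≈⟨ ∑-cong (λ k → ∑-distribʳ (v k) (λ j → a i j * b j k)) ⟩
    (sum λ k → sum λ j → a i j * b j k * v k)    ≈⟨ ∑-comm (λ k j → a i j * b j k * v k) ⟩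
    (sum λ j → sum λ k → a i j * b j k * v k)    ≈⟨ ∑-cong (λ j → ∑-cong λ k → *-assoc _ _ _) ⟩
    (sum λ j → sum λ k → a i j * (b j k * v k))  ≈⟨ ∑-cong (λ j → sym (∑-distribˡ (a i j) (λ k → b j k * v k))) ⟩
    (sum λ j → a i j * (sum λ k → b j k * v k))  ∎

  ⟨⟩-adjoint : ∀ a v w → ⟨ a ▸ v , w ⟩ ≈ ⟨ v , a ᵀ ▸ w ⟩
  ⟨⟩-adjoint a v w = begin
    (sum λ i → (sum λ k → a i k * v k) * w i)  ≈⟨ ∑-cong (λ i → ∑-distribʳ (w i) (λ k → a i k * v k)) ⟩
    (sum λ i → sum λ k → a i k * v k * w i)    ≈⟨ ∑-comm (λ i k → a i k * v k * w i) ⟩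
    (sum λ k → sum λ i → a i k * v k * w i)    ≈⟨ ∑-cong (λ k → ∑-cong λ i → rearrange (a i k) (v k) (w i)) ⟩
    (sum λ k → sum λ i → v k * (a i k * w i))  ≈⟨ ∑-cong (λ k → sym (∑-distribˡ (v k) (λ i → a i k * w i))) ⟩
    (sum λ k → v k * (sum λ i → a i k * w i))  ∎
    where
    rearrange : ∀ x y z → x * y * z ≈ y * (x * z)
    rearrange x y z = trans (*-congʳ (*-comm x y)) (*-assoc y x z)

  form-▸ : ∀ A a v → form A (a ▸ v) ≈ form (a ᵀ ⊙ A ⊙ a) v
  form-▸ A a v = begin
    ⟨ a ▸ v , A ▸ (a ▸ v) ⟩      ≈⟨ ⟨⟩-adjoint a v (A ▸ (a ▸ v)) ⟩
    ⟨ v , a ᵀ ▸ (A ▸ (a ▸ v)) ⟩  ≈⟨ ⟨⟩-congʳ v (≋-sym (▸-assoc (a ᵀ) A (a ▸ v))) ⟩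
    ⟨ v , (a ᵀ ⊙ A) ▸ (a ▸ v) ⟩  ≈⟨ ⟨⟩-congʳ v (≋-sym (▸-assoc (a ᵀ ⊙ A) a v)) ⟩
    ⟨ v , (a ᵀ ⊙ A ⊙ a) ▸ v ⟩    ∎

  ▸-scaleᵥ : ∀ a s v → a ▸ (s ·ᵥ v) ≋ s ·ᵥ (a ▸ v)
  ▸-scaleᵥ a s v i = begin
    (sum λ k → a i k * (s * v k))  ≈⟨ ∑-cong (λ k → trans (sym (*-assoc _ _ _))
                                        (trans (*-congʳ (*-comm _ _)) (*-assoc _ _ _))) ⟩
    (sum λ k → s * (a i k * v k))  ≈⟨ sym (∑-distribˡ s (λ k → a i k * v k)) ⟩
    s * (sum λ k → a i k * v k)    ∎

  ▸-scaleₘ : ∀ s a v → (s ·ₘ a) ▸ v ≋ s ·ᵥ (a ▸ v)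
  ▸-scaleₘ s a v i = trans (∑-cong λ k → *-assoc _ _ _) (sym (∑-distribˡ s (λ k → a i k * v k)))

  ▸-zero : ∀ a → a ▸ zeroᵥ ≋ zeroᵥ
  ▸-zero a i = trans (∑-cong λ k → zeroʳ (a i k)) (sum-replicate-zero n)

open ≡ using (refl; sym; trans; cong; cong₂; isEquivalence)
open ≡.≡-Reasoning

record InversePair {n} (f g : Fin n → Fin n) : Set where
  constructor inverses
  field
    cancelˡ : ∀ x → g (f x) ≡ x
    cancelʳ : ∀ y → f (g y) ≡ y

inverse-∘ : ∀ {n} {f f′ g g′ : Fin n → Fin n} →
  InversePair f f′ → InversePair g g′ → InversePair (f ∘ g) (g′ ∘ f′)
inverse-∘ {f = f} {f′} {g} {g′} (inverses f′f ff′) (inverses g′g gg′) = inverses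
  (λ x → trans (cong g′ (f′f (g x))) (g′g x))
  (λ y → trans (cong f (gg′ (f′ y))) (ff′ y))

inverse-≗ : ∀ {n} {f h g : Fin n → Fin n} → (∀ x → f x ≡ h x) → InversePair f g → InversePair h g
inverse-≗ {g = g} f≗h (inverses gf fg) = inverses
  (λ x → trans (cong g (sym (f≗h x))) (gf x))
  (λ y → trans (sym (f≗h (g y))) (fg y))

-- The permutation with underlying map f when f is a bijection (decided by
-- searching for preimages), and the identity otherwise.
toPerm : ∀ {n} → (Fin n → Fin n) → Permutation′ n
toPerm f with Fin.all? (λ y → Fin.any? λ x → f x Fin.≟ y)
... | no _ = Perm.id
... | yes onto with Fin.all? (λ x → proj₁ (onto (f x)) Fin.≟ x)
...   | no _     = Perm.id
...   | yes back = permutation f (proj₁ ∘ onto) (proj₂ ∘ onto) back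

-- a map with an inverse passes both tests, so toPerm f is f itself
toPerm-apply : ∀ {n} {f g : Fin n → Fin n} → InversePair f g → ∀ i → toPerm f ⟨$⟩ʳ i ≡ f i
toPerm-apply {f = f} {g} (inverses gf fg) i with Fin.all? (λ y → Fin.any? λ x → f x Fin.≟ y)
... | no not-onto = ⊥-elim (not-onto λ y → g y , fg y)
... | yes onto with Fin.all? (λ x → proj₁ (onto (f x)) Fin.≟ x)
...   | yes _       = refl
...   | no not-back = ⊥-elim (not-back λ x → trans (sym (gf _))
                        (trans (cong g (proj₂ (onto (f x)))) (gf x)))

data 𝔽₃ : Set where
  𝟘 𝟙 𝟚 : 𝔽₃

infixl 6 _+_
infixl 7 _*_
infix  8 -_
infix  4 _≟_

_+_ : 𝔽₃ → 𝔽₃ → 𝔽₃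
𝟘 + y = y
𝟙 + 𝟘 = 𝟙
𝟙 + 𝟙 = 𝟚
𝟙 + 𝟚 = 𝟘
𝟚 + 𝟘 = 𝟚
𝟚 + 𝟙 = 𝟘
𝟚 + 𝟚 = 𝟙

-_ : 𝔽₃ → 𝔽₃
- 𝟘 = 𝟘
- 𝟙 = 𝟚
- 𝟚 = 𝟙

_*_ : 𝔽₃ → 𝔽₃ → 𝔽₃
𝟘 * y = 𝟘
𝟙 * y = y
𝟚 * y = - y

_≟_ : DecidableEquality 𝔽₃
𝟘 ≟ 𝟘 = yes refl
𝟙 ≟ 𝟙 = yes refl
𝟚 ≟ 𝟚 = yes refl
𝟘 ≟ 𝟙 = no λ ()
𝟘 ≟ 𝟚 = no λ ()
𝟙 ≟ 𝟘 = no λ ()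
𝟙 ≟ 𝟚 = no λ ()
𝟚 ≟ 𝟘 = no λ ()
𝟚 ≟ 𝟙 = no λ ()

-- Universal statements over 𝔽₃ are decidable; identities in 𝔽₃ are then
-- proved by  from-yes (∀? …),  i.e. by evaluating every instance.
∀? : {P : 𝔽₃ → Set} → (∀ x → Dec (P x)) → Dec (∀ x → P x)
∀? P? with P? 𝟘 | P? 𝟙 | P? 𝟚
... | yes p₀ | yes p₁ | yes p₂ = yes λ { 𝟘 → p₀ ; 𝟙 → p₁ ; 𝟚 → p₂ }
... | no ¬p₀ | _      | _      = no λ p → ¬p₀ (p 𝟘)
... | yes _  | no ¬p₁ | _      = no λ p → ¬p₁ (p 𝟙)
... | yes _  | yes _  | no ¬p₂ = no λ p → ¬p₂ (p 𝟚)

𝔽₃-isCommutativeRing : IsCommutativeRing _≡_ _+_ _*_ -_ 𝟘 𝟙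
𝔽₃-isCommutativeRing = record
  { isRing = record
    { +-isAbelianGroup = record
      { isGroup = record
        { isMonoid = record
          { isSemigroup = record
            { isMagma = record { isEquivalence = isEquivalence ; ∙-cong = cong₂ _+_ }
            ; assoc = from-yes (∀? λ x → ∀? λ y → ∀? λ z → (x + y) + z ≟ x + (y + z)) }
          ; identity = (λ _ → refl) , from-yes (∀? λ x → x + 𝟘 ≟ x) }
        ; inverse = from-yes (∀? λ x → - x + x ≟ 𝟘) , from-yes (∀? λ x → x + - x ≟ 𝟘)
        ; ⁻¹-cong = cong -_ }
      ; comm = from-yes (∀? λ x → ∀? λ y → x + y ≟ y + x) }
    ; *-cong = cong₂ _*_
    ; *-assoc = from-yes (∀? λ x → ∀? λ y → ∀? λ z → (x * y) * z ≟ x * (y * z))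
    ; *-identity = (λ _ → refl) , from-yes (∀? λ x → x * 𝟙 ≟ x)
    ; distrib = from-yes (∀? λ x → ∀? λ y → ∀? λ z → x * (y + z) ≟ x * y + x * z)
              , from-yes (∀? λ x → ∀? λ y → ∀? λ z → (y + z) * x ≟ y * x + z * x) }
  ; *-comm = from-yes (∀? λ x → ∀? λ y → x * y ≟ y * x) }

𝔽₃-commutativeRing : CommutativeRing 0ℓ 0ℓ
𝔽₃-commutativeRing = record { isCommutativeRing = 𝔽₃-isCommutativeRing }

open CommutativeRing 𝔽₃-commutativeRing using (_-_; +-comm; +-identityʳ; semiring; +-commutativeSemigroup)
open import Algebra.Properties.Semiring.Mult semiring using (×-homo-+; ×1-homo-*) renaming (_×_ to _×ₙ_)
open import Algebra.Properties.CommutativeSemigroup +-commutativeSemigroup using (interchange)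

redℕ : ℕ → 𝔽₃
redℕ n = n ×ₙ 𝟙

redℤ : ℤ → 𝔽₃
redℤ (+ n)      = redℕ n
redℤ -[1+ n ]   = - redℕ (ℕ.suc n)

-- the difference of two naturals, which is how integer addition is defined
redℤ-⊖ : ∀ m n → redℤ (m ⊖ n) ≡ redℕ m - redℕ n
redℤ-⊖ ℕ.zero    ℕ.zero    = refl
redℤ-⊖ (ℕ.suc m) ℕ.zero    = sym (+-identityʳ (redℕ (ℕ.suc m)))
redℤ-⊖ ℕ.zero    (ℕ.suc n) = refl
redℤ-⊖ (ℕ.suc m) (ℕ.suc n) = begin
  redℤ (ℕ.suc m ⊖ ℕ.suc n)            ≡⟨ cong redℤ (ℤ.[1+m]⊖[1+n]≡m⊖n m n) ⟩
  redℤ (m ⊖ n)                        ≡⟨ redℤ-⊖ m n ⟩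
  redℕ m - redℕ n                     ≡⟨ shift (redℕ m) (redℕ n) ⟩
  (𝟙 + redℕ m) - (𝟙 + redℕ n)         ∎
  where
  shift : ∀ a b → a - b ≡ (𝟙 + a) - (𝟙 + b)
  shift = from-yes (∀? λ a → ∀? λ b → a - b ≟ (𝟙 + a) - (𝟙 + b))

redℤ-+ : ∀ x y → redℤ (x ℤ.+ y) ≡ redℤ x + redℤ y
redℤ-+ (+ m)      (+ n)      = ×-homo-+ 𝟙 m n
redℤ-+ (+ m)      -[1+ n ]   = redℤ-⊖ m (ℕ.suc n)
redℤ-+ -[1+ m ]   (+ n)      = trans (redℤ-⊖ n (ℕ.suc m)) (+-comm (redℕ n) _)
redℤ-+ -[1+ m ]   -[1+ n ]   = begin
  - (𝟙 + (𝟙 + redℕ (m ℕ.+ n)))            ≡⟨ cong (λ t → - (𝟙 + (𝟙 + t))) (×-homo-+ 𝟙 m n) ⟩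
  - (𝟙 + (𝟙 + (redℕ m + redℕ n)))         ≡⟨ split (redℕ m) (redℕ n) ⟩
  - (𝟙 + redℕ m) + - (𝟙 + redℕ n)         ∎
  where
  split : ∀ a b → - (𝟙 + (𝟙 + (a + b))) ≡ - (𝟙 + a) + - (𝟙 + b)
  split = from-yes (∀? λ a → ∀? λ b → - (𝟙 + (𝟙 + (a + b))) ≟ - (𝟙 + a) + - (𝟙 + b))

redSign : Sign → 𝔽₃
redSign Sign.+ = 𝟙
redSign Sign.- = 𝟚

-- integer multiplication is defined through signs and absolute values
redℤ-◃ : ∀ s n → redℤ (s ◃ n) ≡ redSign s * redℕ n
redℤ-◃ Sign.+ ℕ.zero    = refl
redℤ-◃ Sign.- ℕ.zero    = refl
redℤ-◃ Sign.+ (ℕ.suc n) = refl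
redℤ-◃ Sign.- (ℕ.suc n) = refl

redSign-* : ∀ s t → redSign (s Sign.* t) ≡ redSign s * redSign t
redSign-* Sign.+ Sign.+ = refl
redSign-* Sign.+ Sign.- = refl
redSign-* Sign.- Sign.+ = refl
redSign-* Sign.- Sign.- = refl

redℤ-signAbs : ∀ x → redℤ x ≡ redSign (sign x) * redℕ ∣ x ∣
redℤ-signAbs x = trans (cong redℤ (sym (ℤ.◃-inverse x))) (redℤ-◃ (sign x) ∣ x ∣)

redℤ-* : ∀ x y → redℤ (x ℤ.* y) ≡ redℤ x * redℤ y
redℤ-* x y = begin
  redℤ (sign x Sign.* sign y ◃ ∣ x ∣ ℕ.* ∣ y ∣)        ≡⟨ redℤ-◃ (sign x Sign.* sign y) (∣ x ∣ ℕ.* ∣ y ∣) ⟩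
  redSign (sign x Sign.* sign y) * redℕ (∣ x ∣ ℕ.* ∣ y ∣)
    ≡⟨ cong₂ _*_ (redSign-* (sign x) (sign y)) (×1-homo-* ∣ x ∣ ∣ y ∣) ⟩
  (redSign (sign x) * redSign (sign y)) * (redℕ ∣ x ∣ * redℕ ∣ y ∣)
    ≡⟨ regroup (redSign (sign x)) (redSign (sign y)) (redℕ ∣ x ∣) (redℕ ∣ y ∣) ⟩
  (redSign (sign x) * redℕ ∣ x ∣) * (redSign (sign y) * redℕ ∣ y ∣)
    ≡⟨ sym (cong₂ _*_ (redℤ-signAbs x) (redℤ-signAbs y)) ⟩
  redℤ x * redℤ y                                       ∎
  where
  regroup : ∀ a b c d → (a * b) * (c * d) ≡ (a * c) * (b * d)
  regroup = from-yes (∀? λ a → ∀? λ b → ∀? λ c → ∀? λ d → (a * b) * (c * d) ≟ (a * c) * (b * d))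

redℤ-neg : ∀ x → redℤ (ℤ.- x) ≡ - redℤ x
redℤ-neg (+ ℕ.zero)  = refl
redℤ-neg (+ ℕ.suc n) = refl
redℤ-neg -[1+ n ]    = sym (from-yes (∀? λ a → - - a ≟ a) (redℕ (ℕ.suc n)))

-- Reduction ℤ[ρ] → 𝔽₃ sends ρ to 1 (the residue field at the prime 1 - ρ above 3).
red : ℤρ → 𝔽₃
red (eis a b) = redℤ a + redℤ b

red-⊕ : ∀ x y → red (x ⊕ y) ≡ red x + red y
red-⊕ (eis a b) (eis c d) =
  trans (cong₂ _+_ (redℤ-+ a c) (redℤ-+ b d)) (interchange (redℤ a) (redℤ c) (redℤ b) (redℤ d))

red-⊗ : ∀ x y → red (x ⊗ y) ≡ red x * red y
red-⊗ (eis a b) (eis c d) = begin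
  redℤ (a ℤ.* c ℤ.- b ℤ.* d) + redℤ (a ℤ.* d ℤ.+ b ℤ.* c ℤ.- b ℤ.* d)
    ≡⟨ cong₂ _+_ (trans (redℤ-+ (a ℤ.* c) _) (cong₂ _+_ (redℤ-* a c) (negProduct b d)))
                 (trans (redℤ-+ (a ℤ.* d ℤ.+ b ℤ.* c) _)
                        (cong₂ _+_ (trans (redℤ-+ (a ℤ.* d) _) (cong₂ _+_ (redℤ-* a d) (redℤ-* b c)))
                                   (negProduct b d))) ⟩
  (A * C - B * D) + (A * D + B * C - B * D)   ≡⟨ expand A B C D ⟩
  (A + B) * (C + D)                           ∎
  where
  A B C D : 𝔽₃
  A = redℤ a
  B = redℤ b
  C = redℤ c
  D = redℤ d
  negProduct : ∀ x y → redℤ (ℤ.- (x ℤ.* y)) ≡ - (redℤ x * redℤ y)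
  negProduct x y = trans (redℤ-neg (x ℤ.* y)) (cong -_ (redℤ-* x y))
  -- (a + bρ)(c + dρ) with ρ ↦ 1, using -2 = 1 in 𝔽₃
  expand : ∀ a b c d → (a * c - b * d) + (a * d + b * c - b * d) ≡ (a + b) * (c + d)
  expand = from-yes (∀? λ a → ∀? λ b → ∀? λ c → ∀? λ d →
    (a * c - b * d) + (a * d + b * c - b * d) ≟ (a + b) * (c + d))

red-conj : ∀ x → red (conj x) ≡ red x
red-conj (eis a b) = begin
  redℤ (a ℤ.- b) + redℤ (ℤ.- b)  ≡⟨ cong₂ _+_ (trans (redℤ-+ a (ℤ.- b)) (cong (λ t → redℤ a + t) (redℤ-neg b)))
                                              (redℤ-neg b) ⟩
  (redℤ a - redℤ b) - redℤ b      ≡⟨ twice (redℤ a) (redℤ b) ⟩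
  redℤ a + redℤ b                 ∎
  where
  -- conj (a + bρ) = (a - b) - bρ, and -2 = 1 in 𝔽₃
  twice : ∀ x y → (x - y) - y ≡ x + y
  twice = from-yes (∀? λ x → ∀? λ y → (x - y) - y ≟ x + y)

open SquareMatrices 𝔽₃-commutativeRing 3

redM : Mat → Matrix
redM A i j = red (A i j)

I J : Matrix
I = redM I₃
J = redM J₀

Q : Vector 𝔽₃ 3 → 𝔽₃
Q = form J

-- the sums in Defs.sum3 versus the library sum used by ⊙
red-sum3 : ∀ x y z → red (x ⊕ y ⊕ z) ≡ red x + (red y + (red z + 𝟘))
red-sum3 x y z = begin
  red (x ⊕ y ⊕ z)                ≡⟨ trans (red-⊕ (x ⊕ y) z) (cong (_+ red z) (red-⊕ x y)) ⟩
  (red x + red y) + red z        ≡⟨ reassociate (red x) (red y) (red z) ⟩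
  red x + (red y + (red z + 𝟘))  ∎
  where
  reassociate : ∀ a b c → (a + b) + c ≡ a + (b + (c + 𝟘))
  reassociate = from-yes (∀? λ a → ∀? λ b → ∀? λ c → (a + b) + c ≟ a + (b + (c + 𝟘)))

redM-· : ∀ A B → redM (A · B) ≋ₘ redM A ⊙ redM B
redM-· A B i j = trans (red-sum3 (term 0F) (term 1F) (term 2F))
  (cong₂ _+_ (red-term 0F) (cong₂ _+_ (red-term 1F) (cong (_+ 𝟘) (red-term 2F))))
  where
  term : Fin 3 → ℤρ
  term k = A i k ⊗ B k j
  red-term : ∀ k → red (term k) ≡ red (A i k) * red (B k j)
  red-term k = red-⊗ (A i k) (B k j)

redM-scal : ∀ u A → redM (scal u A) ≋ₘ red u ·ₘ redM A
redM-scal u A i j = red-⊗ u (A i j)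

▸-identity : ∀ v → I ▸ v ≋ v
▸-identity v 0F = +-identityʳ (v 0F)
▸-identity v 1F = +-identityʳ (v 1F)
▸-identity v 2F = +-identityʳ (v 2F)

record Automorphism (m : Matrix) : Set where
  field
    inverse  : Matrix
    inverseˡ : inverse ⊙ m ≋ₘ I
    inverseʳ : m ⊙ inverse ≋ₘ I
    isometry : ∀ v → Q (m ▸ v) ≡ Q v
open Automorphism

automorphism-inverse : ∀ {m} (A : Automorphism m) → Automorphism (inverse A)
automorphism-inverse {m} A = record
  { inverse  = m
  ; inverseˡ = inverseʳ A
  ; inverseʳ = inverseˡ A
  ; isometry = λ v → begin
      Q (inverse A ▸ v)              ≡⟨ sym (isometry A (inverse A ▸ v)) ⟩
      Q (m ▸ (inverse A ▸ v))        ≡⟨ form-congʳ J (≋-sym (▸-assoc m (inverse A) v)) ⟩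
      Q ((m ⊙ inverse A) ▸ v)        ≡⟨ form-congʳ J (▸-congˡ (inverseʳ A) v) ⟩
      Q (I ▸ v)                      ≡⟨ form-congʳ J (▸-identity v) ⟩
      Q v                            ∎ }

redM-unitary : ∀ g → IsU g → Automorphism (redM g)
redM-unitary g ((h , gh≈I , hg≈I) , g-preserves) = record
  { inverse  = redM h
  ; inverseˡ = λ i j → trans (sym (redM-· h g i j)) (cong red (hg≈I i j))
  ; inverseʳ = λ i j → trans (sym (redM-· g h i j)) (cong red (gh≈I i j))
  ; isometry = λ v → trans (form-▸ J (redM g) v) (form-congˡ orthogonal v)
  }
  where
  -- ᵗm J m = J modulo 1 - ρ, since complex conjugation becomes trivial
  conj-trivial : redM g ≋ₘ redM (conjM g)
  conj-trivial k l = sym (red-conj (g k l))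
  orthogonal : redM g ᵀ ⊙ J ⊙ redM g ≋ₘ J
  orthogonal i j = begin
    (redM g ᵀ ⊙ J ⊙ redM g) i j                  ≡⟨ ⊙-congʳ (redM g ᵀ ⊙ J) conj-trivial i j ⟩
    (redM (tr g) ⊙ redM J₀ ⊙ redM (conjM g)) i j ≡⟨ ⊙-congˡ (λ k l → sym (redM-· (tr g) J₀ k l)) (redM (conjM g)) i j ⟩
    (redM (tr g · J₀) ⊙ redM (conjM g)) i j      ≡⟨ sym (redM-· (tr g · J₀) (conjM g) i j) ⟩
    redM (tr g · J₀ · conjM g) i j               ≡⟨ cong red (g-preserves i j) ⟩
    J i j                                        ∎

vec : 𝔽₃ → 𝔽₃ → 𝔽₃ → Vector 𝔽₃ 3
vec a b c 0F = a
vec a b c 1F = b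
vec a b c 2F = c

point : Fin 4 → Vector 𝔽₃ 3
point 0F = vec 𝟙 𝟙 𝟙
point 1F = vec 𝟙 𝟚 𝟙
point 2F = vec 𝟘 𝟘 𝟙
point 3F = vec 𝟙 𝟘 𝟘

-- On the conic a point is determined by its first two coordinates.
label : 𝔽₃ → 𝔽₃ → Fin 4
label 𝟘 _ = 2F
label 𝟙 𝟘 = 3F
label 𝟚 𝟘 = 3F
label 𝟙 𝟙 = 0F
label 𝟚 𝟚 = 0F
label 𝟙 𝟚 = 1F
label 𝟚 𝟙 = 1F

pointOf : Vector 𝔽₃ 3 → Fin 4
pointOf v = label (v 0F) (v 1F)

-- its first non-zero coordinate, the scalar relating v to  point (pointOf v)
leading : Vector 𝔽₃ 3 → 𝔽₃
leading v = first (v 0F) (v 2F)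
  where
  first : 𝔽₃ → 𝔽₃ → 𝔽₃
  first 𝟘 c = c
  first a _ = a

pointOf-cong : ∀ {v w} → v ≋ w → pointOf v ≡ pointOf w
pointOf-cong v≋w = cong₂ label (v≋w 0F) (v≋w 1F)

pointOf-scale : ∀ {s} → s ≢ 𝟘 → ∀ v → pointOf (s ·ᵥ v) ≡ pointOf v
pointOf-scale {𝟘} s≢𝟘 v = ⊥-elim (s≢𝟘 refl)
pointOf-scale {𝟙} _   v = refl
pointOf-scale {𝟚} _   v = from-yes (∀? λ a → ∀? λ b → label (- a) (- b) Fin.≟ label a b) (v 0F) (v 1F)

on-conic : ∀ v → Q v ≡ 𝟘 → v ≋ leading v ·ᵥ point (pointOf v)
on-conic v Qv≡𝟘 = ≋-trans (≋-sym (vec-η v)) (classify (v 0F) (v 1F) (v 2F) Qv≡𝟘)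
  where
  vec-η : ∀ v → vec (v 0F) (v 1F) (v 2F) ≋ v
  vec-η v 0F = refl
  vec-η v 1F = refl
  vec-η v 2F = refl
  classify : ∀ a b c → Q (vec a b c) ≡ 𝟘 → vec a b c ≋ leading (vec a b c) ·ᵥ point (label a b)
  classify = from-yes (∀? λ a → ∀? λ b → ∀? λ c →
    Q (vec a b c) ≟ 𝟘 →-dec Fin.all? λ i → vec a b c i ≟ (leading (vec a b c) ·ᵥ point (label a b)) i)

act : Matrix → Fin 4 → Fin 4
act m i = pointOf (m ▸ point i)

act-cong : ∀ {m m′} → m ≋ₘ m′ → ∀ i → act m i ≡ act m′ i
act-cong m≋m′ i = pointOf-cong (▸-congˡ m≋m′ (point i))

act-scale : ∀ {s} → s ≢ 𝟘 → ∀ m i → act (s ·ₘ m) i ≡ act m i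
act-scale {s} s≢𝟘 m i = trans (pointOf-cong (▸-scaleₘ s m (point i))) (pointOf-scale s≢𝟘 (m ▸ point i))

act-identity : ∀ {m} → m ≋ₘ I → ∀ i → act m i ≡ i
act-identity m≋I i = trans (act-cong m≋I i) (fixed i)
  where
  fixed : ∀ i → act I i ≡ i
  fixed 0F = refl
  fixed 1F = refl
  fixed 2F = refl
  fixed 3F = refl

maps-conic : ∀ {m} → Automorphism m → ∀ i →
  ∃ λ s → s ≢ 𝟘 × m ▸ point i ≋ s ·ᵥ point (act m i)
maps-conic {m} A i = leading (m ▸ point i) , nonzero , on-conic (m ▸ point i) isotropic
  where
  isotropic : Q (m ▸ point i) ≡ 𝟘
  isotropic = trans (isometry A (point i)) (on-conic-point i)
    where
    on-conic-point : ∀ i → Q (point i) ≡ 𝟘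
    on-conic-point 0F = refl
    on-conic-point 1F = refl
    on-conic-point 2F = refl
    on-conic-point 3F = refl
  -- if m sent point i to 0, so would  inverse A ⊙ m ≋ I
  nonzero : leading (m ▸ point i) ≢ 𝟘
  nonzero s≡𝟘 = point-nonzero i (λ k → begin
    point i k                                  ≡⟨ sym (▸-identity (point i) k) ⟩
    (I ▸ point i) k                            ≡⟨ sym (▸-congˡ (inverseˡ A) (point i) k) ⟩
    ((inverse A ⊙ m) ▸ point i) k              ≡⟨ ▸-assoc (inverse A) m (point i) k ⟩
    (inverse A ▸ (m ▸ point i)) k              ≡⟨ ▸-congʳ (inverse A) vanishes k ⟩
    (inverse A ▸ zeroᵥ) k                      ≡⟨ ▸-zero (inverse A) k ⟩
    𝟘                                          ∎)
    where
    vanishes : m ▸ point i ≋ zeroᵥ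
    vanishes k = trans (on-conic (m ▸ point i) isotropic k)
                       (cong (λ s → s * point (act m i) k) s≡𝟘)
    point-nonzero : ∀ i → ¬ (point i ≋ zeroᵥ)
    point-nonzero 0F p = case p 0F of λ ()
    point-nonzero 1F p = case p 0F of λ ()
    point-nonzero 2F p = case p 2F of λ ()
    point-nonzero 3F p = case p 0F of λ ()

act-⊙ : ∀ {b} → Automorphism b → ∀ a i → act (a ⊙ b) i ≡ act a (act b i)
act-⊙ {b} B a i with maps-conic B i
... | s , s≢𝟘 , b▸p≋s·p′ = begin
  pointOf ((a ⊙ b) ▸ point i)                ≡⟨ pointOf-cong (▸-assoc a b (point i)) ⟩
  pointOf (a ▸ (b ▸ point i))                ≡⟨ pointOf-cong (▸-congʳ a b▸p≋s·p′) ⟩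
  pointOf (a ▸ (s ·ᵥ point (act b i)))       ≡⟨ pointOf-cong (▸-scaleᵥ a s (point (act b i))) ⟩
  pointOf (s ·ᵥ (a ▸ point (act b i)))       ≡⟨ pointOf-scale s≢𝟘 (a ▸ point (act b i)) ⟩
  pointOf (a ▸ point (act b i))              ∎

act-invertible : ∀ {m} (A : Automorphism m) → InversePair (act m) (act (inverse A))
act-invertible {m} A = inverses
  (λ x → trans (sym (act-⊙ A (inverse A) x)) (act-identity (inverseˡ A) x))
  (λ y → trans (sym (act-⊙ (automorphism-inverse A) m y)) (act-identity (inverseʳ A) y))

Υ : Mat → S₄
Υ g = toPerm (act (redM g))

Υ-apply : ∀ g {g′} → InversePair (act (redM g)) g′ → ∀ i → Υ g ⟨$⟩ʳ i ≡ act (redM g) i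
Υ-apply g = toPerm-apply

Υ-unitary : ∀ g → IsU g → ∀ i → Υ g ⟨$⟩ʳ i ≡ act (redM g) i
Υ-unitary g u = Υ-apply g (act-invertible (redM-unitary g u))

Υ-multiplicative : ∀ g h → IsU g → IsU h → ∀ i → Υ (g · h) ⟨$⟩ʳ i ≡ Υ g ⟨$⟩ʳ (Υ h ⟨$⟩ʳ i)
Υ-multiplicative g h ug uh i = begin
  Υ (g · h) ⟨$⟩ʳ i                  ≡⟨ Υ-apply (g · h) invertible i ⟩
  act (redM (g · h)) i             ≡⟨ act-gh i ⟩
  act (redM g) (act (redM h) i)    ≡⟨ sym (trans (Υ-unitary g ug _) (cong (act (redM g)) (Υ-unitary h uh i))) ⟩
  Υ g ⟨$⟩ʳ (Υ h ⟨$⟩ʳ i)              ∎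
  where
  G : Automorphism (redM g)
  G = redM-unitary g ug
  H : Automorphism (redM h)
  H = redM-unitary h uh
  act-gh : ∀ i → act (redM (g · h)) i ≡ act (redM g) (act (redM h) i)
  act-gh i = trans (act-cong (redM-· g h) i) (act-⊙ H (redM g) i)
  invertible : InversePair (act (redM (g · h))) (act (inverse H) ∘ act (inverse G))
  invertible = inverse-≗ (sym ∘ act-gh) (inverse-∘ (act-invertible G) (act-invertible H))

-- Υ is constant on classes modulo units: a unit of ℤ[ρ] reduces to a non-zero scalar.
Υ-projective : ∀ g → IsU g → ∀ u → IsUnitℤρ u → Υ (scal u g) ≈ₚ Υ g
Υ-projective g ug u (v , uv≡1) i = begin
  Υ (scal u g) ⟨$⟩ʳ i             ≡⟨ Υ-apply (scal u g) invertible i ⟩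
  act (redM (scal u g)) i        ≡⟨ act-ug i ⟩
  act (redM g) i                 ≡⟨ sym (Υ-unitary g ug i) ⟩
  Υ g ⟨$⟩ʳ i                      ∎
  where
  red-u≢𝟘 : red u ≢ 𝟘
  red-u≢𝟘 red-u≡𝟘 with trans (sym (red-⊗ u v)) (cong red uv≡1)
  ... | ru*rv≡𝟙 rewrite red-u≡𝟘 = case ru*rv≡𝟙 of λ ()
  act-ug : ∀ i → act (redM (scal u g)) i ≡ act (redM g) i
  act-ug i = trans (act-cong (redM-scal u g) i) (act-scale red-u≢𝟘 (redM g) i)
  G : Automorphism (redM g)
  G = redM-unitary g ug
  invertible : InversePair (act (redM (scal u g))) (act (inverse G))
  invertible = inverse-≗ (sym ∘ act-ug) (act-invertible G)

data Generator : Set where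
  r₁ r₂ r₃ : Generator

-ρ : ℤρ
-ρ = -1ρ ⊗ ρ

generator generator⁻¹ : Generator → Mat
generator r₁ = R₁
generator r₂ = R₂
generator r₃ = R₃
generator⁻¹ r₁ = mat 1ρ 0ρ 0ρ 0ρ -ρ 0ρ 0ρ 0ρ 1ρ
generator⁻¹ r₂ = mat 1ρ 0ρ 0ρ -1ρ -ρ 0ρ ρ² -ρ 1ρ
generator⁻¹ r₃ = mat 1ρ -ρ² ρ² 0ρ -ρ -ρ² 0ρ 0ρ 1ρ

image : Generator → S₄
image r₁ = transpose p1 p2
image r₂ = transpose p2 p4
image r₃ = transpose p2 p3

Υ-generator : ∀ x → Υ (generator x) ≈ₚ image x
Υ-generator r₁ = from-yes (Fin.all? λ i → Υ R₁ ⟨$⟩ʳ i Fin.≟ transpose p1 p2 ⟨$⟩ʳ i)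
Υ-generator r₂ = from-yes (Fin.all? λ i → Υ R₂ ⟨$⟩ʳ i Fin.≟ transpose p2 p4 ⟨$⟩ʳ i)
Υ-generator r₃ = from-yes (Fin.all? λ i → Υ R₃ ⟨$⟩ʳ i Fin.≟ transpose p2 p3 ⟨$⟩ʳ i)

_≟ρ_ : DecidableEquality ℤρ
eis a b ≟ρ eis c d =
  Dec.map′ (λ (a≡c , b≡d) → cong₂ eis a≡c b≡d) (λ { refl → refl , refl }) ((a ℤ.≟ c) ×-dec (b ℤ.≟ d))

_≈M?_ : ∀ A B → Dec (A ≈M B)
A ≈M? B = Fin.all? λ i → Fin.all? λ j → A i j ≟ρ B i j

UnitaryWith : Mat → Mat → Set
UnitaryWith g h = ((g · h) ≈M I₃) × ((h · g) ≈M I₃) × ((tr g · J₀ · conjM g) ≈M J₀)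

unitaryWith? : ∀ g h → Dec (UnitaryWith g h)
unitaryWith? g h = ((g · h) ≈M? I₃) ×-dec ((h · g) ≈M? I₃) ×-dec ((tr g · J₀ · conjM g) ≈M? J₀)

unitary : ∀ g h → UnitaryWith g h → IsU g
unitary g h (gh≈I , hg≈I , preserves) = (h , gh≈I , hg≈I) , preserves

generator-unitary : ∀ x → IsU (generator x)
generator-unitary r₁ = unitary R₁ (generator⁻¹ r₁) (from-yes (unitaryWith? R₁ (generator⁻¹ r₁)))
generator-unitary r₂ = unitary R₂ (generator⁻¹ r₂) (from-yes (unitaryWith? R₂ (generator⁻¹ r₂)))
generator-unitary r₃ = unitary R₃ (generator⁻¹ r₃) (from-yes (unitaryWith? R₃ (generator⁻¹ r₃)))

Word : Set
Word = List Generator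

-- entries stored explicitly, so that each is evaluated only once
tabulate : Mat → Mat
tabulate A = mat (A 0F 0F) (A 0F 1F) (A 0F 2F) (A 1F 0F) (A 1F 1F) (A 1F 2F) (A 2F 0F) (A 2F 1F) (A 2F 2F)

evalWord evalWord⁻¹ : Word → Mat
evalWord   = foldr (λ x g → tabulate (generator x · g)) I₃
evalWord⁻¹ = foldr (λ x g → tabulate (g · generator⁻¹ x)) I₃

imageWord : Word → Fin 4 → Fin 4
imageWord = foldr (λ x f → (image x ⟨$⟩ʳ_) ∘ f) id

UnitarySuffixes : Word → Set
UnitarySuffixes []      = ⊤
UnitarySuffixes (x ∷ w) = UnitaryWith (evalWord (x ∷ w)) (evalWord⁻¹ (x ∷ w)) × UnitarySuffixes w

unitarySuffixes? : ∀ w → Dec (UnitarySuffixes w)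
unitarySuffixes? []      = yes tt
unitarySuffixes? (x ∷ w) = unitaryWith? (evalWord (x ∷ w)) (evalWord⁻¹ (x ∷ w)) ×-dec unitarySuffixes? w

evalWord-unitary : ∀ w → UnitarySuffixes w → IsU (evalWord w)
evalWord-unitary []      _       = unitary I₃ I₃ (from-yes (unitaryWith? I₃ I₃))
evalWord-unitary (x ∷ w) (u , _) = unitary (evalWord (x ∷ w)) (evalWord⁻¹ (x ∷ w)) u

Υ-word : ∀ w → UnitarySuffixes w → ∀ i → Υ (evalWord w) ⟨$⟩ʳ i ≡ imageWord w i
Υ-word []      _        = from-yes (Fin.all? λ i → Υ I₃ ⟨$⟩ʳ i Fin.≟ i)
Υ-word (x ∷ w) (_ , us) i = begin
  Υ (generator x · evalWord w) ⟨$⟩ʳ i          ≡⟨ Υ-multiplicative (generator x) (evalWord w)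
                                                    (generator-unitary x) (evalWord-unitary w us) i ⟩
  Υ (generator x) ⟨$⟩ʳ (Υ (evalWord w) ⟨$⟩ʳ i)  ≡⟨ Υ-generator x _ ⟩
  image x ⟨$⟩ʳ (Υ (evalWord w) ⟨$⟩ʳ i)          ≡⟨ cong (image x ⟨$⟩ʳ_) (Υ-word w us i) ⟩
  image x ⟨$⟩ʳ imageWord w i                   ∎

-- Every permutation is the prescribed image of a word of length ≤ 4 whose
-- suffixes are unitary (checked on all maps Fin 4 → Fin 4).

words : ℕ → List Word
words ℕ.zero    = [] ∷ []
words (ℕ.suc n) = [] ∷ concatMap (λ x → map (x ∷_) (words n)) (r₁ ∷ r₂ ∷ r₃ ∷ [])

wordFor : (Fin 4 → Fin 4) → Word
wordFor f = fromMaybe [] (head (filter (λ w → Fin.all? λ i → imageWord w i Fin.≟ f i) (words 4)))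

Lifts : (Fin 4 → Fin 4) → Set
Lifts f = (∀ i → imageWord (wordFor f) i ≡ f i) × UnitarySuffixes (wordFor f)

values : Fin 4 → Fin 4 → Fin 4 → Fin 4 → Fin 4 → Fin 4
values a b c d 0F = a
values a b c d 1F = b
values a b c d 2F = c
values a b c d 3F = d

Injective₄ : (Fin 4 → Fin 4) → Set
Injective₄ f = ∀ x y → f x ≡ f y → x ≡ y

every-permutation-lifts : ∀ a b c d → Injective₄ (values a b c d) → Lifts (values a b c d)
every-permutation-lifts = from-yes (Fin.all? λ a → Fin.all? λ b → Fin.all? λ c → Fin.all? λ d →
  (Fin.all? λ x → Fin.all? λ y → (values a b c d x Fin.≟ values a b c d y) →-dec (x Fin.≟ y))
    →-dec (Fin.all? (λ i → imageWord (wordFor (values a b c d)) i Fin.≟ values a b c d i)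
           ×-dec unitarySuffixes? (wordFor (values a b c d))))

Υ-surjective : IsSurjPU Υ
Υ-surjective σ = evalWord w , evalWord-unitary w (proj₂ lifts) , λ i → begin
  Υ (evalWord w) ⟨$⟩ʳ i  ≡⟨ Υ-word w (proj₂ lifts) i ⟩
  imageWord w i         ≡⟨ proj₁ lifts i ⟩
  f i                   ≡⟨ f≗σ i ⟩
  σ ⟨$⟩ʳ i               ∎
  where
  f : Fin 4 → Fin 4
  f = values (σ ⟨$⟩ʳ 0F) (σ ⟨$⟩ʳ 1F) (σ ⟨$⟩ʳ 2F) (σ ⟨$⟩ʳ 3F)
  f≗σ : ∀ i → f i ≡ σ ⟨$⟩ʳ i
  f≗σ 0F = refl
  f≗σ 1F = refl
  f≗σ 2F = refl
  f≗σ 3F = refl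
  f-injective : Injective₄ f
  f-injective x y fx≡fy = begin
    x                  ≡⟨ sym (Perm.inverseˡ σ) ⟩
    σ ⟨$⟩ˡ (σ ⟨$⟩ʳ x)   ≡⟨ cong (σ ⟨$⟩ˡ_) (trans (sym (f≗σ x)) (trans fx≡fy (f≗σ y))) ⟩
    σ ⟨$⟩ˡ (σ ⟨$⟩ʳ y)   ≡⟨ Perm.inverseˡ σ ⟩
    y                  ∎
  w : Word
  w = wordFor f
  lifts : Lifts f
  lifts = every-permutation-lifts _ _ _ _ f-injective

mainTheorem4 : ∃ λ (Υ : Mat → S₄) →
    IsPUHom Υ ×
    (Υ R₁ ≈ₚ transpose p1 p2) ×
    (Υ R₂ ≈ₚ transpose p2 p4) ×
    (Υ R₃ ≈ₚ transpose p2 p3) ×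
    IsSurjPU Υ
mainTheorem4 =
  Υ , (Υ-projective , Υ-multiplicative) , Υ-generator r₁ , Υ-generator r₂ , Υ-generator r₃ , Υ-surjective
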